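{- Let $s,t$ be integers with $2 \leq s \leq t$. Then for $n \geq 1$, \[ \textup{ex}_{\chi \leq 3}(n, K_{s,t}) \leq \left(\frac{1}{3}\right)^{1-1/s}\left(\frac{t-1}{2} + o(1)\right)^{1/s} n^{2-1/s}, \] where $o(1)$ denotes a quantity tending to $0$ as $n \to \infty$ (with $s,t$ fixed).
   Context: For a graph $F$ and an integer $k \geq 2$, $\textup{ex}_{\chi \leq k}(n,F)$ denotes the maximum number of edges in an $n$-vertex graph $G$ that has no subgraph isomorphic to $F$ and has chromatic number at most $k$ (equivalently, $G$ is $k$-partite). $K_{s,t}$ is the complete bipartite graph with parts of sizes $s$ and $t$. -}

module Defs where

open import Data.Nat using (ℕ; zero; suc; _+_; _*_; _^_; _<_)
open import Data.Fin using (Fin; _<?_)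
open import Data.Bool using (Bool; true; false)
open import Data.List using (List; map; length; filter)
open import Data.Nat.ListAction using (sum)
open import Data.List.Base using (allFin)
open import Data.Product using (Σ; ∃; _×_; _,_)
open import Relation.Binary.PropositionalEquality using (_≡_; _≢_)
open import Relation.Nullary using (¬_)
open import Function.Definitions using (Injective)

record Graph (n : ℕ) : Set where
  field
    adj   : Fin n → Fin n → Bool
    sym   : ∀ i j → adj i j ≡ adj j i
    irrefl : ∀ i → adj i i ≡ false

open Graph public

edgeCount : ∀ {n} → Graph n → ℕ
edgeCount {n} G =
  sum (map (λ i → length (filter (λ j → i <? j) (filter (λ j → Data.Bool._≟_ (adj G i j) true) (allFin n)))) (allFin n))
  where import Data.Bool

Colourable : ∀ {n} → ℕ → Graph n → Set
Colourable {n} k G =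
  Σ (Fin n → Fin k) λ c → ∀ i j → adj G i j ≡ true → c i ≢ c j

ContainsKst : ∀ {n} → ℕ → ℕ → Graph n → Set
ContainsKst {n} s t G =
  Σ (Fin s → Fin n) λ a → Σ (Fin t → Fin n) λ b →
    Injective _≡_ _≡_ a × Injective _≡_ _≡_ b ×
    (∀ i j → a i ≢ b j) × (∀ i j → adj G (a i) (b j) ≡ true)

module Submission where

-- For a class P let x_P be the number
-- of edges leaving P. Counting the s-sets inside P that lie in the neighbourhood of a vertex
-- outside P (Kővári–Sós–Turán) gives r_P^s ≤ (t−1) |P| (|P||V∖P|)^(s−1) for r_P = x_P ∸ s|V∖P|,
-- and Hölder's inequality sums these to R^s ≤ (t−1) n W^(s−1) for R = Σ_P r_P, where
-- W = Σ_P |P||V∖P| ≤ (1 − 1/c) n². Meanwhile 2e(G) = Σ_P x_P ≤ R + s(c−1)n, and for c = 3 the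
-- linear error term s(c−1)n is absorbed once n is large.

open import Defs hiding (sym)

open import Data.Bool using (Bool; true; false; _∧_; T) renaming (_≟_ to _≟ᵇ_)
open import Data.Bool.ListAction using (all)
open import Data.Bool.Properties using (∧-identityʳ; ∧-zeroʳ; T-≡)
open import Data.Empty using (⊥-elim)
open import Data.Fin using (Fin; zero; suc; inject≤; _<?_) renaming (_≟_ to _≟ᶠ_)
open import Data.Fin.Properties using (inject≤-injective)
open import Data.List using (List; []; _∷_; _++_; [_]; map; length; lookup; filter; allFin)
open import Data.List.Membership.Propositional using (_∈_)
open import Data.List.Membership.Propositional.Properties using (∈-lookup; ∈-++⁻; ∈-map⁻; ∈-filter⁻)
open import Data.List.Properties using (map-tabulate; length-++; length-map; length-tabulate)
open import Data.List.Relation.Binary.Subset.Propositional using (_⊆_)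
open import Data.List.Relation.Unary.All as All using (All)
open import Data.List.Relation.Unary.AllPairs using ([]; _∷_)
open import Data.List.Relation.Unary.Any using (here; there)
open import Data.List.Relation.Unary.All.Properties using (all⁺)
open import Data.List.Relation.Unary.Unique.Propositional using (Unique)
open import Data.List.Relation.Unary.Unique.Propositional.Properties using (allFin⁺; filter⁺)
open import Data.Nat using (ℕ; zero; suc; _+_; _*_; _∸_; _^_; _!; _≤_; _<_; z≤n; s≤s; _≤?_)
open import Data.Nat.ListAction using (sum)
open import Data.Nat.Combinatorics using (_C_; nCk+nC[k+1]≡[n+1]C[k+1]; nCk≡nPk/k!; k>n⇒nCk≡0)
open import Data.Nat.Combinatorics.Base using (_P′_)
open import Data.Nat.Combinatorics.Specification using (k!∣nP′k; nPk≡n!/[n∸k]!; nP′k≡n!/[n∸k]!)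
open import Data.Nat.DivMod using (/-congˡ; m*[n/m]≡n) renaming (_/_ to _div_)
open import Data.Nat.Properties hiding (_<?_)
open import Data.Nat.Tactic.RingSolver using (solve-∀)
open import Data.Product using (Σ; ∃; _×_; _,_; proj₁; proj₂)
open import Data.Sum using (_⊎_; inj₁; inj₂)
open import Function using (_∘_; id)
open import Function.Bundles using (Equivalence)
open import Function.Definitions using (Injective)
open import Relation.Binary.PropositionalEquality
  using (_≡_; _≢_; refl; sym; trans; cong; cong₂; subst; subst₂; module ≡-Reasoning)
open import Relation.Nullary using (Dec; yes; no; does; ¬_; ¬?)
open import Relation.Nullary.Decidable using (T?)
open import Relation.Unary using (Pred; Decidable)

open import Algebra.Properties.CommutativeSemigroup +-commutativeSemigroup
  using () renaming (interchange to +-interchange; x∙yz≈y∙xz to x+[y+z]≡y+[x+z])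
open import Algebra.Properties.CommutativeSemigroup *-commutativeSemigroup
  using (x∙yz≈y∙xz; xy∙z≈y∙xz) renaming (interchange to *-interchange)

module _ {A : Set} where

  ∑ : (A → ℕ) → List A → ℕ
  ∑ f []       = 0
  ∑ f (x ∷ xs) = f x + ∑ f xs

  ∑-mono-≤ : ∀ {f g : A → ℕ} xs → (∀ x → f x ≤ g x) → ∑ f xs ≤ ∑ g xs
  ∑-mono-≤ []       f≤g = z≤n
  ∑-mono-≤ (x ∷ xs) f≤g = +-mono-≤ (f≤g x) (∑-mono-≤ xs f≤g)

  ∑-cong : ∀ {f g : A → ℕ} xs → (∀ x → f x ≡ g x) → ∑ f xs ≡ ∑ g xs
  ∑-cong []       f≡g = refl
  ∑-cong (x ∷ xs) f≡g = cong₂ _+_ (f≡g x) (∑-cong xs f≡g)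

  ∑-∈-zero : ∀ (f : A → ℕ) xs → (∀ {x} → x ∈ xs → f x ≡ 0) → ∑ f xs ≡ 0
  ∑-∈-zero f []       _     = refl
  ∑-∈-zero f (x ∷ xs) f≡0 = cong₂ _+_ (f≡0 (here refl)) (∑-∈-zero f xs (f≡0 ∘ there))

  ∑-distrib-+ : ∀ (f g : A → ℕ) xs → ∑ (λ x → f x + g x) xs ≡ ∑ f xs + ∑ g xs
  ∑-distrib-+ f g []       = refl
  ∑-distrib-+ f g (x ∷ xs) =
    trans (cong (f x + g x +_) (∑-distrib-+ f g xs)) (+-interchange (f x) (g x) (∑ f xs) (∑ g xs))

  ∑-distribˡ-* : ∀ c (f : A → ℕ) xs → ∑ (λ x → c * f x) xs ≡ c * ∑ f xs
  ∑-distribˡ-* c f []       = sym (*-zeroʳ c)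
  ∑-distribˡ-* c f (x ∷ xs) =
    trans (cong (c * f x +_) (∑-distribˡ-* c f xs)) (sym (*-distribˡ-+ c (f x) (∑ f xs)))

  ∑-const : ∀ c (xs : List A) → ∑ (λ _ → c) xs ≡ c * length xs
  ∑-const c []       = sym (*-zeroʳ c)
  ∑-const c (x ∷ xs) = trans (cong (c +_) (∑-const c xs)) (sym (*-suc c (length xs)))

  ∑-zero : ∀ (xs : List A) → ∑ (λ _ → 0) xs ≡ 0
  ∑-zero xs = trans (∑-const 0 xs) (*-zeroˡ (length xs))

  ∑1≡length : ∀ (xs : List A) → ∑ (λ _ → 1) xs ≡ length xs
  ∑1≡length xs = trans (∑-const 1 xs) (*-identityˡ (length xs))

  ∑-++ : ∀ (f : A → ℕ) xs ys → ∑ f (xs ++ ys) ≡ ∑ f xs + ∑ f ys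
  ∑-++ f []       ys = refl
  ∑-++ f (x ∷ xs) ys = trans (cong (f x +_) (∑-++ f xs ys)) (sym (+-assoc (f x) (∑ f xs) (∑ f ys)))

  ∑-filter-split : ∀ {p} {P : Pred A p} (P? : Decidable P) (f : A → ℕ) xs →
    ∑ f xs ≡ ∑ f (filter P? xs) + ∑ f (filter (¬? ∘ P?) xs)
  ∑-filter-split P? f []       = refl
  ∑-filter-split P? f (x ∷ xs) with does (P? x)
  ... | true  = trans (cong (f x +_) (∑-filter-split P? f xs)) (sym (+-assoc (f x) _ _))
  ... | false = trans (cong (f x +_) (∑-filter-split P? f xs))
                      (x+[y+z]≡y+[x+z] (f x) (∑ f (filter P? xs)) (∑ f (filter (¬? ∘ P?) xs)))

  sum-map≡∑ : ∀ (f : A → ℕ) xs → sum (map f xs) ≡ ∑ f xs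
  sum-map≡∑ f []       = refl
  sum-map≡∑ f (x ∷ xs) = cong (f x +_) (sum-map≡∑ f xs)

∑-map : ∀ {A B : Set} (f : B → ℕ) (g : A → B) xs → ∑ f (map g xs) ≡ ∑ (f ∘ g) xs
∑-map f g []       = refl
∑-map f g (x ∷ xs) = cong (f (g x) +_) (∑-map f g xs)

∑-comm : ∀ {A B : Set} (h : A → B → ℕ) xs ys →
  ∑ (λ x → ∑ (h x) ys) xs ≡ ∑ (λ y → ∑ (λ x → h x y) xs) ys
∑-comm h []       ys = sym (∑-zero ys)
∑-comm h (x ∷ xs) ys =
  trans (cong (∑ (h x) ys +_) (∑-comm h xs ys)) (sym (∑-distrib-+ (h x) (λ y → ∑ (λ x → h x y) xs) ys))

length-allFin : ∀ n → length (allFin n) ≡ n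
length-allFin n = length-tabulate id

∑-allFin-suc : ∀ {k} (f : Fin (suc k) → ℕ) → ∑ f (allFin (suc k)) ≡ f zero + ∑ (f ∘ suc) (allFin k)
∑-allFin-suc {k} f =
  cong (f zero +_) (trans (cong (∑ f) (sym (map-tabulate id suc))) (∑-map f suc (allFin k)))

indicator : Bool → ℕ
indicator true  = 1
indicator false = 0

indicator-exclusive : ∀ {P Q : Set} (P? : Dec P) (Q? : Dec Q) → (P → ¬ Q) → ∀ b →
  indicator (does P? ∧ b) + indicator (does Q? ∧ b) ≤ indicator b
indicator-exclusive (yes p) (yes q) ¬pq _ = ⊥-elim (¬pq p q)
indicator-exclusive (yes _) (no _)  _   b = ≤-reflexive (+-identityʳ (indicator b))
indicator-exclusive (no _)  (yes _) _   _ = ≤-refl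
indicator-exclusive (no _)  (no _)  _   _ = z≤n

module _ {A : Set} where

  count : (A → Bool) → List A → ℕ
  count p = ∑ (indicator ∘ p)

  length-filter≡count : ∀ {p} {P : Pred A p} (P? : Decidable P) xs →
    length (filter P? xs) ≡ count (does ∘ P?) xs
  length-filter≡count P? []       = refl
  length-filter≡count P? (x ∷ xs) with does (P? x)
  ... | true  = cong suc (length-filter≡count P? xs)
  ... | false = length-filter≡count P? xs

  count-filter : ∀ q {p} {P : Pred A p} (P? : Decidable P) xs →
    count q (filter P? xs) ≡ count (λ x → q x ∧ does (P? x)) xs
  count-filter q P? []       = refl
  count-filter q P? (x ∷ xs) with does (P? x)
  ... | true  = cong₂ _+_ (cong indicator (sym (∧-identityʳ (q x)))) (count-filter q P? xs)
  ... | false = trans (count-filter q P? xs)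
                      (cong (_+ count (λ x → q x ∧ does (P? x)) xs) (cong indicator (sym (∧-zeroʳ (q x)))))

count-≟-allFin : ∀ {k} (c : Fin k) → count (λ P → does (c ≟ᶠ P)) (allFin k) ≡ 1
count-≟-allFin {suc k} c = trans (∑-allFin-suc (λ P → indicator (does (c ≟ᶠ P)))) (first-or-later c)
  where
  first-or-later : ∀ c → indicator (does (c ≟ᶠ zero)) + count (λ P → does (c ≟ᶠ suc P)) (allFin k) ≡ 1
  first-or-later zero    = cong suc (∑-zero (allFin k))
  first-or-later (suc c) = count-≟-allFin c

module _ {A : Set} where

  ∑≤*length⊎∃< : ∀ (f : A → ℕ) t xs → ∑ f xs ≤ t * length xs ⊎ ∃ λ x → x ∈ xs × t < f x
  ∑≤*length⊎∃< f t []       = inj₁ z≤n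
  ∑≤*length⊎∃< f t (x ∷ xs) with f x ≤? t | ∑≤*length⊎∃< f t xs
  ... | no fx≰t | _                    = inj₂ (x , here refl , ≰⇒> fx≰t)
  ... | yes _   | inj₂ (y , y∈xs , lt) = inj₂ (y , there y∈xs , lt)
  ... | yes fx≤t | inj₁ ∑≤             =
    inj₁ (≤-trans (+-mono-≤ fx≤t ∑≤) (≤-reflexive (sym (*-suc t (length xs)))))

  lookup-injective : ∀ {xs : List A} → Unique xs → ∀ i j → lookup xs i ≡ lookup xs j → i ≡ j
  lookup-injective {x ∷ xs} _            zero    zero    _  = refl
  lookup-injective {x ∷ xs} (x∉xs ∷ _)   zero    (suc j) eq = ⊥-elim (All.lookup x∉xs (∈-lookup j) eq)
  lookup-injective {x ∷ xs} (x∉xs ∷ _)   (suc i) zero    eq = ⊥-elim (All.lookup x∉xs (∈-lookup i) (sym eq))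
  lookup-injective {x ∷ xs} (_ ∷ unique) (suc i) (suc j) eq = cong suc (lookup-injective unique i j eq)

  enumerate : ∀ {m} (xs : List A) → m ≤ length xs → Fin m → A
  enumerate xs m≤∣xs∣ i = lookup xs (inject≤ i m≤∣xs∣)

  enumerate-∈ : ∀ {m} xs (m≤∣xs∣ : m ≤ length xs) i → enumerate xs m≤∣xs∣ i ∈ xs
  enumerate-∈ xs m≤∣xs∣ i = ∈-lookup (inject≤ i m≤∣xs∣)

  enumerate-injective : ∀ {m} {xs} (m≤∣xs∣ : m ≤ length xs) → Unique xs →
    Injective _≡_ _≡_ (enumerate xs m≤∣xs∣)
  enumerate-injective m≤∣xs∣ unique {i} {j} eq =
    inject≤-injective m≤∣xs∣ m≤∣xs∣ i j (lookup-injective unique _ _ eq)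

  combinations : ℕ → List A → List (List A)
  combinations zero    xs       = [ [] ]
  combinations (suc k) []       = []
  combinations (suc k) (x ∷ xs) = map (x ∷_) (combinations k xs) ++ combinations (suc k) xs

  length-combinations : ∀ k xs → length (combinations k xs) ≡ length xs C k
  length-combinations zero    xs       = refl
  length-combinations (suc k) []       = refl
  length-combinations (suc k) (x ∷ xs) = begin
    length (map (x ∷_) (combinations k xs) ++ combinations (suc k) xs)
      ≡⟨ length-++ (map (x ∷_) (combinations k xs)) ⟩
    length (map (x ∷_) (combinations k xs)) + length (combinations (suc k) xs)
      ≡⟨ cong₂ _+_ (trans (length-map (x ∷_) (combinations k xs)) (length-combinations k xs))
                   (length-combinations (suc k) xs) ⟩
    length xs C k + length xs C suc k
      ≡⟨ nCk+nC[k+1]≡[n+1]C[k+1] (length xs) k ⟩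
    suc (length xs) C suc k ∎
    where open ≡-Reasoning

  count-all-combinations : ∀ q k xs → count (all q) (combinations k xs) ≡ count q xs C k
  count-all-combinations q zero    xs       = refl
  count-all-combinations q (suc k) []       = refl
  count-all-combinations q (suc k) (x ∷ xs) = begin
    count (all q) (map (x ∷_) (combinations k xs) ++ combinations (suc k) xs)
      ≡⟨ ∑-++ (indicator ∘ all q) (map (x ∷_) (combinations k xs)) (combinations (suc k) xs) ⟩
    count (all q) (map (x ∷_) (combinations k xs)) + count (all q) (combinations (suc k) xs)
      ≡⟨ cong₂ _+_ (∑-map (indicator ∘ all q) (x ∷_) (combinations k xs))
                   (count-all-combinations q (suc k) xs) ⟩
    count (λ S → q x ∧ all q S) (combinations k xs) + count q xs C suc k
      ≡⟨ pascal (q x) ⟩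
    (indicator (q x) + count q xs) C suc k ∎
    where
    open ≡-Reasoning
    pascal : ∀ b → count (λ S → b ∧ all q S) (combinations k xs) + count q xs C suc k
                   ≡ (indicator b + count q xs) C suc k
    pascal true  = trans (cong (_+ count q xs C suc k) (count-all-combinations q k xs))
                         (nCk+nC[k+1]≡[n+1]C[k+1] (count q xs) k)
    pascal false = cong (_+ count q xs C suc k) (∑-zero (combinations k xs))

  ∈-combinations⁻ : ∀ k xs {S} → S ∈ combinations k xs → length S ≡ k × S ⊆ xs
  ∈-combinations⁻ zero    xs       (here refl) = refl , λ ()
  ∈-combinations⁻ (suc k) (x ∷ xs) S∈ with ∈-++⁻ (map (x ∷_) (combinations k xs)) S∈
  ... | inj₂ S∈′ = let (∣S∣≡ , S⊆xs) = ∈-combinations⁻ (suc k) xs S∈′ in ∣S∣≡ , there ∘ S⊆xs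
  ... | inj₁ S∈′ with ∈-map⁻ (x ∷_) S∈′
  ... | S′ , S′∈ , refl =
    cong suc ∣S′∣≡ , λ { (here y≡x) → here y≡x ; (there y∈S′) → there (S′⊆xs y∈S′) }
    where
    ∣S′∣≡ = proj₁ (∈-combinations⁻ k xs S′∈)
    S′⊆xs = proj₂ (∈-combinations⁻ k xs S′∈)

  combinations-unique : ∀ k {xs S} → Unique xs → S ∈ combinations k xs → Unique S
  combinations-unique zero    {xs}     _                (here refl) = []
  combinations-unique (suc k) {x ∷ xs} (x∉xs ∷ unique) S∈ with ∈-++⁻ (map (x ∷_) (combinations k xs)) S∈
  ... | inj₂ S∈′ = combinations-unique (suc k) unique S∈′
  ... | inj₁ S∈′ with ∈-map⁻ (x ∷_) S∈′
  ... | S′ , S′∈ , refl =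
    All.tabulate (λ y∈S′ → All.lookup x∉xs (proj₂ (∈-combinations⁻ k xs S′∈) y∈S′))
      ∷ combinations-unique k unique S′∈

-- Power inequalities

^-distribʳ-* : ∀ m n k → (m * n) ^ k ≡ m ^ k * n ^ k
^-distribʳ-* m n zero    = refl
^-distribʳ-* m n (suc k) = trans (cong (m * n *_) (^-distribʳ-* m n k)) (*-interchange m n (m ^ k) (n ^ k))

rearrangement-≤ : ∀ k {a b} → a ≤ b → a * b ^ k + b * a ^ k ≤ a * a ^ k + b * b ^ k
rearrangement-≤ k {a} {b} a≤b =
  subst (λ b → a * b ^ k + b * a ^ k ≤ a * a ^ k + b * b ^ k) (m+[n∸m]≡n a≤b) (shifted (b ∸ a))
  where
  open ≤-Reasoning
  shifted : ∀ d → a * (a + d) ^ k + (a + d) * a ^ k ≤ a * a ^ k + (a + d) * (a + d) ^ k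
  shifted d = begin
    a * (a + d) ^ k + (a + d) * a ^ k               ≡⟨ cong (a * (a + d) ^ k +_) (*-distribʳ-+ (a ^ k) a d) ⟩
    a * (a + d) ^ k + (a * a ^ k + d * a ^ k)       ≡⟨ x+[y+z]≡y+[x+z] (a * (a + d) ^ k) (a * a ^ k) (d * a ^ k) ⟩
    a * a ^ k + (a * (a + d) ^ k + d * a ^ k)       ≤⟨ +-monoʳ-≤ (a * a ^ k) (+-monoʳ-≤ (a * (a + d) ^ k)
                                                         (*-monoʳ-≤ d (^-monoˡ-≤ k (m≤m+n a d)))) ⟩
    a * a ^ k + (a * (a + d) ^ k + d * (a + d) ^ k) ≡⟨ cong (a * a ^ k +_) (*-distribʳ-+ ((a + d) ^ k) a d) ⟨
    a * a ^ k + (a + d) * (a + d) ^ k               ∎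

rearrangement : ∀ k a b → a * b ^ k + b * a ^ k ≤ a * a ^ k + b * b ^ k
rearrangement k a b with ≤-total a b
... | inj₁ a≤b = rearrangement-≤ k a≤b
... | inj₂ b≤a =
  subst₂ _≤_ (+-comm (b * a ^ k) (a * b ^ k)) (+-comm (b * b ^ k) (a * a ^ k)) (rearrangement-≤ k b≤a)

-- With a = R₁ w₂ and b = R₂ w₁, the two cross terms of the left side are a b^(k+1) and b a^(k+1),
-- and those of the right side are a^(k+2) and b^(k+2).
holder-step : ∀ k R₁ R₂ w₁ w₂ →
  (R₁ + R₂) * (w₁ * w₂) * (R₁ ^ suc k * w₂ ^ k + R₂ ^ suc k * w₁ ^ k)
    ≤ (R₁ ^ suc (suc k) * w₂ ^ suc k + R₂ ^ suc (suc k) * w₁ ^ suc k) * (w₁ + w₂)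
holder-step k R₁ R₂ w₁ w₂ = begin
  (R₁ + R₂) * (w₁ * w₂) * (R₁ * R₁ᵏ * w₂ᵏ + R₂ * R₂ᵏ * w₁ᵏ)
    ≡⟨ expandˡ R₁ R₂ w₁ w₂ R₁ᵏ R₂ᵏ w₁ᵏ w₂ᵏ ⟩
  D + (a * (R₂ * R₂ᵏ * (w₁ * w₁ᵏ)) + b * (R₁ * R₁ᵏ * (w₂ * w₂ᵏ)))
    ≡⟨ cong₂ (λ x y → D + (a * x + b * y)) powb powa ⟨
  D + (a * b ^ suc k + b * a ^ suc k)
    ≤⟨ +-monoʳ-≤ D (rearrangement (suc k) a b) ⟩
  D + (a * a ^ suc k + b * b ^ suc k)
    ≡⟨ cong₂ (λ x y → D + (a * x + b * y)) powa powb ⟩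
  D + (a * (R₁ * R₁ᵏ * (w₂ * w₂ᵏ)) + b * (R₂ * R₂ᵏ * (w₁ * w₁ᵏ)))
    ≡⟨ expandʳ R₁ R₂ w₁ w₂ R₁ᵏ R₂ᵏ w₁ᵏ w₂ᵏ ⟩
  (R₁ * (R₁ * R₁ᵏ) * (w₂ * w₂ᵏ) + R₂ * (R₂ * R₂ᵏ) * (w₁ * w₁ᵏ)) * (w₁ + w₂) ∎
  where
  open ≤-Reasoning
  R₁ᵏ = R₁ ^ k
  R₂ᵏ = R₂ ^ k
  w₁ᵏ = w₁ ^ k
  w₂ᵏ = w₂ ^ k
  a = R₁ * w₂
  b = R₂ * w₁
  D = R₁ * R₁ * R₁ᵏ * w₁ * w₂ * w₂ᵏ + R₂ * R₂ * R₂ᵏ * w₁ * w₂ * w₁ᵏ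
  powa : a ^ suc k ≡ R₁ * R₁ᵏ * (w₂ * w₂ᵏ)
  powa = ^-distribʳ-* R₁ w₂ (suc k)
  powb : b ^ suc k ≡ R₂ * R₂ᵏ * (w₁ * w₁ᵏ)
  powb = ^-distribʳ-* R₂ w₁ (suc k)
  expandˡ : ∀ R₁ R₂ w₁ w₂ R₁ᵏ R₂ᵏ w₁ᵏ w₂ᵏ →
    (R₁ + R₂) * (w₁ * w₂) * (R₁ * R₁ᵏ * w₂ᵏ + R₂ * R₂ᵏ * w₁ᵏ)
      ≡ (R₁ * R₁ * R₁ᵏ * w₁ * w₂ * w₂ᵏ + R₂ * R₂ * R₂ᵏ * w₁ * w₂ * w₁ᵏ)
        + (R₁ * w₂ * (R₂ * R₂ᵏ * (w₁ * w₁ᵏ)) + R₂ * w₁ * (R₁ * R₁ᵏ * (w₂ * w₂ᵏ)))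
  expandˡ = solve-∀
  expandʳ : ∀ R₁ R₂ w₁ w₂ R₁ᵏ R₂ᵏ w₁ᵏ w₂ᵏ →
    (R₁ * R₁ * R₁ᵏ * w₁ * w₂ * w₂ᵏ + R₂ * R₂ * R₂ᵏ * w₁ * w₂ * w₁ᵏ)
        + (R₁ * w₂ * (R₁ * R₁ᵏ * (w₂ * w₂ᵏ)) + R₂ * w₁ * (R₂ * R₂ᵏ * (w₁ * w₁ᵏ)))
      ≡ (R₁ * (R₁ * R₁ᵏ) * (w₂ * w₂ᵏ) + R₂ * (R₂ * R₂ᵏ) * (w₁ * w₁ᵏ)) * (w₁ + w₂)
  expandʳ = solve-∀

holder₂-cleared : ∀ k R₁ R₂ w₁ w₂ →
  (R₁ + R₂) ^ suc k * (w₁ * w₂) ^ k ≤ (R₁ ^ suc k * w₂ ^ k + R₂ ^ suc k * w₁ ^ k) * (w₁ + w₂) ^ k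
holder₂-cleared zero    R₁ R₂ w₁ w₂ = ≤-reflexive (unit R₁ R₂)
  where
  unit : ∀ R₁ R₂ → (R₁ + R₂) * 1 * 1 ≡ (R₁ * 1 * 1 + R₂ * 1 * 1) * 1
  unit = solve-∀
holder₂-cleared (suc k) R₁ R₂ w₁ w₂ = begin
  (R₁ + R₂) ^ suc (suc k) * (w₁ * w₂) ^ suc k
    ≡⟨ *-interchange (R₁ + R₂) ((R₁ + R₂) ^ suc k) (w₁ * w₂) ((w₁ * w₂) ^ k) ⟩
  (R₁ + R₂) * (w₁ * w₂) * ((R₁ + R₂) ^ suc k * (w₁ * w₂) ^ k)
    ≤⟨ *-monoʳ-≤ ((R₁ + R₂) * (w₁ * w₂)) (holder₂-cleared k R₁ R₂ w₁ w₂) ⟩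
  (R₁ + R₂) * (w₁ * w₂) * (X * W ^ k)
    ≡⟨ *-assoc ((R₁ + R₂) * (w₁ * w₂)) X (W ^ k) ⟨
  (R₁ + R₂) * (w₁ * w₂) * X * W ^ k
    ≤⟨ *-monoˡ-≤ (W ^ k) (holder-step k R₁ R₂ w₁ w₂) ⟩
  X′ * W * W ^ k
    ≡⟨ *-assoc X′ W (W ^ k) ⟩
  X′ * W ^ suc k ∎
  where
  open ≤-Reasoning
  W  = w₁ + w₂
  X  = R₁ ^ suc k * w₂ ^ k + R₂ ^ suc k * w₁ ^ k
  X′ = R₁ ^ suc (suc k) * w₂ ^ suc k + R₂ ^ suc (suc k) * w₁ ^ suc k

m^[2+k]≤n*0^[1+k]⇒m≡0 : ∀ k {m n} → m ^ suc (suc k) ≤ n * 0 ^ suc k → m ≡ 0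
m^[2+k]≤n*0^[1+k]⇒m≡0 k {m} {n} le =
  m^n≡0⇒m≡0 m (suc (suc k)) (n≤0⇒n≡0 (≤-trans le (≤-reflexive (*-zeroʳ n))))

holder₂ : ∀ k {R₁ R₂ a₁ a₂ w₁ w₂} → R₁ ^ suc k ≤ a₁ * w₁ ^ k → R₂ ^ suc k ≤ a₂ * w₂ ^ k →
  (R₁ + R₂) ^ suc k ≤ (a₁ + a₂) * (w₁ + w₂) ^ k
holder₂ zero {R₁} {R₂} {a₁} {a₂} h₁ h₂ = begin
  (R₁ + R₂) * 1 ≡⟨ *-identityʳ (R₁ + R₂) ⟩
  R₁ + R₂       ≤⟨ +-mono-≤ (drop-*1 {R₁} {a₁} h₁) (drop-*1 {R₂} {a₂} h₂) ⟩
  a₁ + a₂       ≡⟨ *-identityʳ (a₁ + a₂) ⟨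
  (a₁ + a₂) * 1 ∎
  where
  open ≤-Reasoning
  drop-*1 : ∀ {x y} → x * 1 ≤ y * 1 → x ≤ y
  drop-*1 {x} {y} = subst₂ _≤_ (*-identityʳ x) (*-identityʳ y)
holder₂ (suc k) {R₁} {R₂} {a₁} {a₂} {zero} {w₂} h₁ h₂
  rewrite m^[2+k]≤n*0^[1+k]⇒m≡0 k {R₁} {a₁} h₁ =
  ≤-trans h₂ (*-monoˡ-≤ (w₂ ^ suc k) (m≤n+m a₂ a₁))
holder₂ (suc k) {R₁} {R₂} {a₁} {a₂} {w₁@(suc _)} {zero} h₁ h₂
  rewrite m^[2+k]≤n*0^[1+k]⇒m≡0 k {R₂} {a₂} h₂ =
  subst₂ _≤_ (cong (_^ suc (suc k)) (sym (+-identityʳ R₁)))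
             (cong (λ w → (a₁ + a₂) * w ^ suc k) (sym (+-identityʳ w₁)))
    (≤-trans h₁ (*-monoˡ-≤ (w₁ ^ suc k) (m≤m+n a₁ a₂)))
holder₂ (suc k) {R₁} {R₂} {a₁} {a₂} {w₁@(suc _)} {w₂@(suc _)} h₁ h₂ =
  *-cancelʳ-≤ ((R₁ + R₂) ^ suc K) ((a₁ + a₂) * W ^ K) ((w₁ * w₂) ^ K) {{m^n≢0 (w₁ * w₂) K}} (begin
    (R₁ + R₂) ^ suc K * (w₁ * w₂) ^ K
      ≤⟨ holder₂-cleared K R₁ R₂ w₁ w₂ ⟩
    (R₁ ^ suc K * w₂ ^ K + R₂ ^ suc K * w₁ ^ K) * W ^ K
      ≤⟨ *-monoˡ-≤ (W ^ K) (+-mono-≤ (*-monoˡ-≤ (w₂ ^ K) h₁) (*-monoˡ-≤ (w₁ ^ K) h₂)) ⟩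
    (a₁ * w₁ ^ K * w₂ ^ K + a₂ * w₂ ^ K * w₁ ^ K) * W ^ K
      ≡⟨ collect a₁ a₂ (w₁ ^ K) (w₂ ^ K) (W ^ K) ⟩
    (a₁ + a₂) * W ^ K * (w₁ ^ K * w₂ ^ K)
      ≡⟨ cong ((a₁ + a₂) * W ^ K *_) (^-distribʳ-* w₁ w₂ K) ⟨
    (a₁ + a₂) * W ^ K * (w₁ * w₂) ^ K ∎)
  where
  open ≤-Reasoning
  K = suc k
  W = w₁ + w₂
  collect : ∀ a₁ a₂ x y z → (a₁ * x * y + a₂ * y * x) * z ≡ (a₁ + a₂) * z * (x * y)
  collect = solve-∀

holder : ∀ k {A : Set} (r a w : A → ℕ) xs → (∀ x → r x ^ suc k ≤ a x * w x ^ k) →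
  ∑ r xs ^ suc k ≤ ∑ a xs * ∑ w xs ^ k
holder k r a w []       _    = z≤n
holder k r a w (x ∷ xs) hyps =
  holder₂ k {r x} {∑ r xs} {a x} {∑ a xs} {w x} {∑ w xs} (hyps x) (holder k r a w xs hyps)

power-mean : ∀ k {A : Set} (y : A → ℕ) xs → ∑ y xs ^ suc k ≤ ∑ (λ x → y x ^ suc k) xs * length xs ^ k
power-mean k y xs = subst (λ L → ∑ y xs ^ suc k ≤ ∑ (λ x → y x ^ suc k) xs * L ^ k) (∑1≡length xs)
  (holder k y (λ x → y x ^ suc k) (λ _ → 1) xs
    (λ x → ≤-reflexive (sym (trans (cong (y x ^ suc k *_) (^-zeroˡ k)) (*-identityʳ (y x ^ suc k))))))

module _ {A : Set} (p q : A → ℕ) (xs : List A) {n : ℕ}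
         (p+q≡n : ∀ x → p x + q x ≡ n) (∑p≡n : ∑ p xs ≡ n) where

  ∑-complement : ∑ q xs ≡ (length xs ∸ 1) * n
  ∑-complement = begin
    ∑ q xs                     ≡⟨ m+n∸m≡n (∑ p xs) (∑ q xs) ⟨
    ∑ p xs + ∑ q xs ∸ ∑ p xs   ≡⟨ cong₂ _∸_ (sym (∑-distrib-+ p q xs)) ∑p≡n ⟩
    ∑ (λ x → p x + q x) xs ∸ n ≡⟨ cong (_∸ n) (trans (∑-cong xs p+q≡n) (∑-const n xs)) ⟩
    n * length xs ∸ n          ≡⟨ cong₂ _∸_ (*-comm n (length xs)) (sym (*-identityˡ n)) ⟩
    length xs * n ∸ 1 * n      ≡⟨ *-distribʳ-∸ n (length xs) 1 ⟨
    (length xs ∸ 1) * n        ∎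
    where open ≡-Reasoning

  -- ∑ p q = n² - ∑ p², and n² ≤ |xs| ∑ p² by the power mean inequality.
  ∑-product-balance : length xs * ∑ (λ x → p x * q x) xs ≤ (length xs ∸ 1) * (n * n)
  ∑-product-balance = begin
    L * W                     ≡⟨ m+n∸n≡m (L * W) (n * n) ⟨
    L * W + n * n ∸ n * n     ≤⟨ ∸-monoˡ-≤ (n * n) (+-monoʳ-≤ (L * W) n²≤L*S) ⟩
    L * W + L * S ∸ n * n     ≡⟨ cong (_∸ n * n) (trans (sym (*-distribˡ-+ L W S)) (cong (L *_) W+S≡n²)) ⟩
    L * (n * n) ∸ n * n       ≡⟨ cong (L * (n * n) ∸_) (sym (*-identityˡ (n * n))) ⟩
    L * (n * n) ∸ 1 * (n * n) ≡⟨ *-distribʳ-∸ (n * n) L 1 ⟨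
    (L ∸ 1) * (n * n)         ∎
    where
    open ≤-Reasoning
    L = length xs
    W = ∑ (λ x → p x * q x) xs
    S = ∑ (λ x → p x * p x) xs
    W+S≡n² : W + S ≡ n * n
    W+S≡n² = begin-equality
      W + S
        ≡⟨ +-comm W S ⟩
      S + W
        ≡⟨ ∑-distrib-+ (λ x → p x * p x) (λ x → p x * q x) xs ⟨
      ∑ (λ x → p x * p x + p x * q x) xs
        ≡⟨ ∑-cong xs (λ x → trans (sym (*-distribˡ-+ (p x) (p x) (q x))) (cong (p x *_) (p+q≡n x))) ⟩
      ∑ (λ x → p x * n) xs
        ≡⟨ ∑-cong xs (λ x → *-comm (p x) n) ⟩
      ∑ (λ x → n * p x) xs
        ≡⟨ ∑-distribˡ-* n p xs ⟩
      n * ∑ p xs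
        ≡⟨ cong (n *_) ∑p≡n ⟩
      n * n ∎
    n²≤L*S : n * n ≤ L * S
    n²≤L*S = begin
      n * n
        ≡⟨ cong (λ m → m * m) ∑p≡n ⟨
      ∑ p xs * ∑ p xs
        ≡⟨ cong (∑ p xs *_) (*-identityʳ (∑ p xs)) ⟨
      ∑ p xs ^ 2
        ≤⟨ power-mean 1 p xs ⟩
      ∑ (λ x → p x ^ 2) xs * L ^ 1
        ≡⟨ cong₂ _*_ (∑-cong xs (λ x → cong (p x *_) (*-identityʳ (p x)))) (*-identityʳ L) ⟩
      S * L
        ≡⟨ *-comm S L ⟩
      L * S ∎

n*[n*n]^k≡n^[2k+1] : ∀ n k → n * (n * n) ^ k ≡ n ^ (2 * suc k ∸ 1)
n*[n*n]^k≡n^[2k+1] n k = begin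
  n * (n * n) ^ k       ≡⟨ cong (n *_) (^-distribʳ-* n n k) ⟩
  n * (n ^ k * n ^ k)   ≡⟨ cong (n *_) (^-distribˡ-+-* n k k) ⟨
  n ^ suc (k + k)       ≡⟨ cong (λ m → n ^ suc (k + m)) (+-identityʳ k) ⟨
  n ^ suc (k + (k + 0)) ≡⟨ cong (n ^_) (+-suc k (k + 0)) ⟨
  n ^ (k + suc (k + 0)) ∎
  where open ≡-Reasoning

-- Binomial coefficients

[n∸k]^k≤nP′k : ∀ n k → (n ∸ k) ^ k ≤ n P′ k
[n∸k]^k≤nP′k n zero    = ≤-refl
[n∸k]^k≤nP′k n (suc k) =
  *-mono-≤ n∸[1+k]≤n∸k (≤-trans (^-monoˡ-≤ k n∸[1+k]≤n∸k) ([n∸k]^k≤nP′k n k))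
  where
  n∸[1+k]≤n∸k = ∸-monoʳ-≤ n (n≤1+n k)

nP′k≤n^k : ∀ n k → n P′ k ≤ n ^ k
nP′k≤n^k n zero    = ≤-refl
nP′k≤n^k n (suc k) = *-mono-≤ (m∸n≤m n k) (nP′k≤n^k n k)

k!*nCk≡nP′k : ∀ {n k} → k ≤ n → k ! * (n C k) ≡ n P′ k
k!*nCk≡nP′k {n} {k} k≤n = begin
  k ! * (n C k)
    ≡⟨ cong (k ! *_) (trans (nCk≡nPk/k! k≤n) (/-congˡ (trans (nPk≡n!/[n∸k]! k≤n) (sym (nP′k≡n!/[n∸k]! k≤n))))) ⟩
  k ! * ((n P′ k) div k !)
    ≡⟨ m*[n/m]≡n (k!∣nP′k k≤n) ⟩
  n P′ k ∎
  where
  open ≡-Reasoning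
  instance _ = k !≢0

[n∸k]^k≤k!*nCk : ∀ n k → (n ∸ k) ^ k ≤ k ! * (n C k)
[n∸k]^k≤k!*nCk n zero    = ≤-refl
[n∸k]^k≤k!*nCk n (suc k) with suc k ≤? n
... | yes 1+k≤n = ≤-trans ([n∸k]^k≤nP′k n (suc k)) (≤-reflexive (sym (k!*nCk≡nP′k 1+k≤n)))
... | no 1+k≰n rewrite m≤n⇒m∸n≡0 (<⇒≤ (≰⇒> 1+k≰n)) = z≤n

k!*nCk≤n^k : ∀ n k → k ! * (n C k) ≤ n ^ k
k!*nCk≤n^k n k with k ≤? n
... | yes k≤n = ≤-trans (≤-reflexive (k!*nCk≡nP′k k≤n)) (nP′k≤n^k n k)
... | no k≰n rewrite k>n⇒nCk≡0 (≰⇒> k≰n) | *-zeroʳ (k !) = z≤n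

degree-power-bound : ∀ k {A : Set} (d : A → ℕ) (O : List A) t p →
  ∑ (λ v → d v C suc k) O ≤ t * (p C suc k) →
  (∑ d O ∸ suc k * length O) ^ suc k ≤ t * p * (p * length O) ^ k
degree-power-bound k d O t p ∑dCs≤tpCs = begin
  (∑ d O ∸ s * q) ^ s
    ≤⟨ ^-monoˡ-≤ s ∑d∸sq≤∑y ⟩
  ∑ y O ^ s
    ≤⟨ power-mean k y O ⟩
  ∑ (λ v → y v ^ s) O * q ^ k
    ≤⟨ *-monoˡ-≤ (q ^ k) (∑-mono-≤ O (λ v → [n∸k]^k≤k!*nCk (d v) s)) ⟩
  ∑ (λ v → s ! * (d v C s)) O * q ^ k
    ≡⟨ cong (_* q ^ k) (∑-distribˡ-* (s !) (λ v → d v C s) O) ⟩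
  s ! * ∑ (λ v → d v C s) O * q ^ k
    ≤⟨ *-monoˡ-≤ (q ^ k) (*-monoʳ-≤ (s !) ∑dCs≤tpCs) ⟩
  s ! * (t * (p C s)) * q ^ k
    ≡⟨ cong (_* q ^ k) (x∙yz≈y∙xz (s !) t (p C s)) ⟩
  t * (s ! * (p C s)) * q ^ k
    ≤⟨ *-monoˡ-≤ (q ^ k) (*-monoʳ-≤ t (k!*nCk≤n^k p s)) ⟩
  t * (p * p ^ k) * q ^ k
    ≡⟨ trans (cong (_* q ^ k) (sym (*-assoc t p (p ^ k)))) (*-assoc (t * p) (p ^ k) (q ^ k)) ⟩
  t * p * (p ^ k * q ^ k)
    ≡⟨ cong (t * p *_) (^-distribʳ-* p q k) ⟨
  t * p * (p * q) ^ k ∎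
  where
  open ≤-Reasoning
  s = suc k
  q = length O
  y = λ v → d v ∸ s
  ∑d∸sq≤∑y : ∑ d O ∸ s * q ≤ ∑ y O
  ∑d∸sq≤∑y = m≤n+o⇒m∸n≤o (∑ d O) (s * q) (begin
    ∑ d O                 ≤⟨ ∑-mono-≤ O (λ v → m≤n+m∸n (d v) s) ⟩
    ∑ (λ v → s + y v) O   ≡⟨ ∑-distrib-+ (λ _ → s) y O ⟩
    ∑ (λ _ → s) O + ∑ y O ≡⟨ cong (_+ ∑ y O) (∑-const s O) ⟩
    s * q + ∑ y O         ∎)

degree : ∀ {n} → Graph n → Fin n → ℕ
degree {n} G v = count (adj G v) (allFin n)

module _ {n} (G : Graph n) where

  private
    V = allFin n

  edgeCount≡∑-forward : edgeCount G ≡ ∑ (λ v → count (λ u → does (v <? u) ∧ adj G v u) V) V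
  edgeCount≡∑-forward = trans (sum-map≡∑ _ V) (∑-cong V λ v → begin
    length (filter (v <?_) (filter (λ u → adj G v u ≟ᵇ true) V))
      ≡⟨ length-filter≡count (v <?_) (filter (λ u → adj G v u ≟ᵇ true) V) ⟩
    count (λ u → does (v <? u)) (filter (λ u → adj G v u ≟ᵇ true) V)
      ≡⟨ count-filter (λ u → does (v <? u)) (λ u → adj G v u ≟ᵇ true) V ⟩
    count (λ u → does (v <? u) ∧ does (adj G v u ≟ᵇ true)) V
      ≡⟨ ∑-cong V (λ u → cong (λ b → indicator (does (v <? u) ∧ b)) (does-≟-true (adj G v u))) ⟩
    count (λ u → does (v <? u) ∧ adj G v u) V ∎)
    where
    open ≡-Reasoning
    does-≟-true : ∀ b → does (b ≟ᵇ true) ≡ b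
    does-≟-true true  = refl
    does-≟-true false = refl

  edgeCount≡∑-backward : edgeCount G ≡ ∑ (λ v → count (λ u → does (u <? v) ∧ adj G v u) V) V
  edgeCount≡∑-backward = trans edgeCount≡∑-forward (trans
    (∑-comm (λ u v → indicator (does (u <? v) ∧ adj G u v)) V V)
    (∑-cong V λ v → ∑-cong V λ u → cong (λ b → indicator (does (u <? v) ∧ b)) (Graph.sym G u v)))

  handshake : 2 * edgeCount G ≤ ∑ (degree G) V
  handshake = begin
    2 * edgeCount G                    ≡⟨ cong (edgeCount G +_) (+-identityʳ (edgeCount G)) ⟩
    edgeCount G + edgeCount G          ≡⟨ cong₂ _+_ edgeCount≡∑-forward edgeCount≡∑-backward ⟩
    ∑ forward V + ∑ backward V         ≡⟨ ∑-distrib-+ forward backward V ⟨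
    ∑ (λ v → forward v + backward v) V ≤⟨ ∑-mono-≤ V at-most-once ⟩
    ∑ (degree G) V                     ∎
    where
    open ≤-Reasoning
    forward backward : Fin n → ℕ
    forward  v = count (λ u → does (v <? u) ∧ adj G v u) V
    backward v = count (λ u → does (u <? v) ∧ adj G v u) V
    at-most-once : ∀ v → forward v + backward v ≤ degree G v
    at-most-once v = ≤-trans (≤-reflexive (sym (∑-distrib-+ _ _ V)))
      (∑-mono-≤ V (λ u → indicator-exclusive (v <? u) (u <? v) <-asym (adj G v u)))

-- Double count the pairs (v, S) with v ∈ O and S an s-subset of the neighbourhood of v in L;
-- an S with more than t such v spans a K_{s,t+1}.
kst-count : ∀ {n} (G : Graph n) s t {L O : List (Fin n)} → Unique L → Unique O →
  (∀ {u v} → u ∈ L → v ∈ O → u ≢ v) → ¬ ContainsKst s (suc t) G →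
  ∑ (λ v → count (adj G v) L C s) O ≤ t * (length L C s)
kst-count G s t {L} {O} L-unique O-unique disjoint K-free
  with ∑≤*length⊎∃< (λ S → count (λ v → all (adj G v) S) O) t (combinations s L)
... | inj₁ few-common = begin
  ∑ (λ v → count (adj G v) L C s) O
    ≡⟨ ∑-cong O (λ v → count-all-combinations (adj G v) s L) ⟨
  ∑ (λ v → count (all (adj G v)) (combinations s L)) O
    ≡⟨ ∑-comm (λ v S → indicator (all (adj G v) S)) O (combinations s L) ⟩
  ∑ (λ S → count (λ v → all (adj G v) S) O) (combinations s L)
    ≤⟨ few-common ⟩
  t * length (combinations s L)
    ≡⟨ cong (t *_) (length-combinations s L) ⟩
  t * (length L C s) ∎
  where open ≤-Reasoning
... | inj₂ (S , S∈ , t<common) =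
  ⊥-elim (K-free (a , b , enumerate-injective ∣S∣≥s S-unique , enumerate-injective ∣N∣>t N-unique ,
                  a≢b , a-adj-b))
  where
  N = filter (λ v → T? (all (adj G v) S)) O
  ∣S∣≥s : s ≤ length S
  ∣S∣≥s = ≤-reflexive (sym (proj₁ (∈-combinations⁻ s L S∈)))
  ∣N∣>t : suc t ≤ length N
  ∣N∣>t = subst (suc t ≤_) (sym (length-filter≡count (λ v → T? (all (adj G v) S)) O)) t<common
  S-unique = combinations-unique s L-unique S∈
  N-unique = filter⁺ (λ v → T? (all (adj G v) S)) O-unique
  a = enumerate S ∣S∣≥s
  b = enumerate N ∣N∣>t
  b-common : ∀ j → b j ∈ O × T (all (adj G (b j)) S)
  b-common j = ∈-filter⁻ (λ v → T? (all (adj G v) S)) (enumerate-∈ N ∣N∣>t j)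
  a≢b : ∀ i j → a i ≢ b j
  a≢b i j = disjoint (proj₂ (∈-combinations⁻ s L S∈) (enumerate-∈ S ∣S∣≥s i)) (proj₁ (b-common j))
  a-adj-b : ∀ i j → adj G (a i) (b j) ≡ true
  a-adj-b i j = trans (Graph.sym G (a i) (b j))
    (Equivalence.to T-≡ (All.lookup (all⁺ (adj G (b j)) S (proj₂ (b-common j))) (enumerate-∈ S ∣S∣≥s i)))

module ColourClasses {n c : ℕ} (col : Fin n → Fin c) where

  private
    V = allFin n

  class outside : Fin c → List (Fin n)
  class   P = filter (λ u → col u ≟ᶠ P) V
  outside P = filter (λ u → ¬? (col u ≟ᶠ P)) V

  class-unique : ∀ P → Unique (class P)
  class-unique P = filter⁺ (λ u → col u ≟ᶠ P) (allFin⁺ n)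

  outside-unique : ∀ P → Unique (outside P)
  outside-unique P = filter⁺ (λ u → ¬? (col u ≟ᶠ P)) (allFin⁺ n)

  ∈-class⁻ : ∀ {P u} → u ∈ class P → col u ≡ P
  ∈-class⁻ {P} u∈ = proj₂ (∈-filter⁻ (λ u → col u ≟ᶠ P) {xs = V} u∈)

  ∈-outside⁻ : ∀ {P u} → u ∈ outside P → col u ≢ P
  ∈-outside⁻ {P} u∈ = proj₂ (∈-filter⁻ (λ u → ¬? (col u ≟ᶠ P)) {xs = V} u∈)

  class-outside-disjoint : ∀ P {u v} → u ∈ class P → v ∈ outside P → u ≢ v
  class-outside-disjoint P u∈ v∈ refl = ∈-outside⁻ v∈ (∈-class⁻ u∈)

  ∣class∣+∣outside∣≡n : ∀ P → length (class P) + length (outside P) ≡ n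
  ∣class∣+∣outside∣≡n P = begin
    length (class P) + length (outside P)
      ≡⟨ cong₂ _+_ (∑1≡length (class P)) (∑1≡length (outside P)) ⟨
    ∑ (λ _ → 1) (class P) + ∑ (λ _ → 1) (outside P)
      ≡⟨ ∑-filter-split (λ u → col u ≟ᶠ P) (λ _ → 1) V ⟨
    ∑ (λ _ → 1) V
      ≡⟨ trans (∑1≡length V) (length-allFin n) ⟩
    n ∎
    where open ≡-Reasoning

  ∑∣class∣≡n : ∑ (λ P → length (class P)) (allFin c) ≡ n
  ∑∣class∣≡n = begin
    ∑ (λ P → length (class P)) (allFin c)
      ≡⟨ ∑-cong (allFin c) (λ P → length-filter≡count (λ u → col u ≟ᶠ P) V) ⟩
    ∑ (λ P → count (λ u → does (col u ≟ᶠ P)) V) (allFin c)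
      ≡⟨ ∑-comm (λ P u → indicator (does (col u ≟ᶠ P))) (allFin c) V ⟩
    ∑ (λ u → count (λ P → does (col u ≟ᶠ P)) (allFin c)) V
      ≡⟨ ∑-cong V (λ u → count-≟-allFin (col u)) ⟩
    ∑ (λ _ → 1) V
      ≡⟨ trans (∑1≡length V) (length-allFin n) ⟩
    n ∎
    where open ≡-Reasoning

  module _ (G : Graph n) where

    crossing : Fin c → ℕ
    crossing P = ∑ (λ v → count (adj G v) (class P)) (outside P)

    degree≡∑-count-class : ∀ v → degree G v ≡ ∑ (λ P → count (adj G v) (class P)) (allFin c)
    degree≡∑-count-class v = begin
      count (adj G v) V
        ≡⟨ ∑-cong V split ⟩
      ∑ (λ u → count (λ P → adj G v u ∧ does (col u ≟ᶠ P)) (allFin c)) V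
        ≡⟨ ∑-comm (λ P u → indicator (adj G v u ∧ does (col u ≟ᶠ P))) (allFin c) V ⟨
      ∑ (λ P → count (λ u → adj G v u ∧ does (col u ≟ᶠ P)) V) (allFin c)
        ≡⟨ ∑-cong (allFin c) (λ P → count-filter (adj G v) (λ u → col u ≟ᶠ P) V) ⟨
      ∑ (λ P → count (adj G v) (class P)) (allFin c) ∎
      where
      open ≡-Reasoning
      split : ∀ u → indicator (adj G v u) ≡ count (λ P → adj G v u ∧ does (col u ≟ᶠ P)) (allFin c)
      split u with adj G v u
      ... | true  = sym (count-≟-allFin (col u))
      ... | false = sym (∑-zero (allFin c))

    ∑degree≡∑crossing : (∀ i j → adj G i j ≡ true → col i ≢ col j) →
      ∑ (degree G) V ≡ ∑ crossing (allFin c)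
    ∑degree≡∑crossing proper = begin
      ∑ (degree G) V
        ≡⟨ ∑-cong V degree≡∑-count-class ⟩
      ∑ (λ v → ∑ (λ P → count (adj G v) (class P)) (allFin c)) V
        ≡⟨ ∑-comm (λ v P → count (adj G v) (class P)) V (allFin c) ⟩
      ∑ (λ P → ∑ (λ v → count (adj G v) (class P)) V) (allFin c)
        ≡⟨ ∑-cong (allFin c) inside-vanishes ⟩
      ∑ crossing (allFin c) ∎
      where
      open ≡-Reasoning
      non-adjacent : ∀ P {u v} → u ∈ class P → v ∈ class P → adj G v u ≡ false
      non-adjacent P {u} {v} u∈ v∈ with adj G v u in eq
      ... | true  = ⊥-elim (proper v u eq (trans (∈-class⁻ v∈) (sym (∈-class⁻ u∈))))
      ... | false = refl
      inside-vanishes : ∀ P → ∑ (λ v → count (adj G v) (class P)) V ≡ crossing P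
      inside-vanishes P = begin
        ∑ (λ v → count (adj G v) (class P)) V
          ≡⟨ ∑-filter-split (λ u → col u ≟ᶠ P) (λ v → count (adj G v) (class P)) V ⟩
        ∑ (λ v → count (adj G v) (class P)) (class P) + crossing P
          ≡⟨ cong (_+ crossing P) (∑-∈-zero _ (class P) (λ v∈ →
               ∑-∈-zero _ (class P) (λ u∈ → cong indicator (non-adjacent P u∈ v∈)))) ⟩
        crossing P ∎

    crossing-bound : ∀ k t → ¬ ContainsKst (suc k) (suc t) G → ∀ P →
      (crossing P ∸ suc k * length (outside P)) ^ suc k
        ≤ t * length (class P) * (length (class P) * length (outside P)) ^ k
    crossing-bound k t K-free P =
      degree-power-bound k (λ v → count (adj G v) (class P)) (outside P) t (length (class P))
      (kst-count G (suc k) t (class-unique P) (outside-unique P) (class-outside-disjoint P) K-free)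

multipartite-bound : ∀ k t {n c} (G : Graph n) → Colourable c G → ¬ ContainsKst (suc k) (suc t) G →
  ∃ λ R → c ^ k * R ^ suc k ≤ t * (c ∸ 1) ^ k * n ^ (2 * suc k ∸ 1)
        × 2 * edgeCount G ≤ R + suc k * (c ∸ 1) * n
multipartite-bound k t {n} {c} G (col , proper) K-free = R , R-bound , edge-bound
  where
  open ColourClasses col
  s = suc k
  Ps = allFin c
  p q r : Fin c → ℕ
  p P = length (class P)
  q P = length (outside P)
  r P = crossing G P ∸ s * q P
  R = ∑ r Ps
  W = ∑ (λ P → p P * q P) Ps
  cW≤[c∸1]n² : c * W ≤ (c ∸ 1) * (n * n)
  cW≤[c∸1]n² = subst (λ L → L * W ≤ (L ∸ 1) * (n * n)) (length-allFin c)
    (∑-product-balance p q Ps ∣class∣+∣outside∣≡n ∑∣class∣≡n)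
  R-bound : c ^ k * R ^ s ≤ t * (c ∸ 1) ^ k * n ^ (2 * s ∸ 1)
  R-bound = begin
    c ^ k * R ^ s                          ≤⟨ *-monoʳ-≤ (c ^ k) Rˢ≤tnWᵏ ⟩
    c ^ k * (∑ (λ P → t * p P) Ps * W ^ k) ≡⟨ cong (λ z → c ^ k * (z * W ^ k)) ∑tp≡tn ⟩
    c ^ k * (t * n * W ^ k)                ≡⟨ x∙yz≈y∙xz (c ^ k) (t * n) (W ^ k) ⟩
    t * n * (c ^ k * W ^ k)                ≡⟨ cong (t * n *_) (^-distribʳ-* c W k) ⟨
    t * n * (c * W) ^ k                    ≤⟨ *-monoʳ-≤ (t * n) (^-monoˡ-≤ k cW≤[c∸1]n²) ⟩
    t * n * ((c ∸ 1) * (n * n)) ^ k        ≡⟨ cong (t * n *_) (^-distribʳ-* (c ∸ 1) (n * n) k) ⟩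
    t * n * ((c ∸ 1) ^ k * (n * n) ^ k)    ≡⟨ *-interchange t n ((c ∸ 1) ^ k) ((n * n) ^ k) ⟩
    t * (c ∸ 1) ^ k * (n * (n * n) ^ k)    ≡⟨ cong (t * (c ∸ 1) ^ k *_) (n*[n*n]^k≡n^[2k+1] n k) ⟩
    t * (c ∸ 1) ^ k * n ^ (2 * s ∸ 1)      ∎
    where
    open ≤-Reasoning
    Rˢ≤tnWᵏ : R ^ s ≤ ∑ (λ P → t * p P) Ps * W ^ k
    Rˢ≤tnWᵏ = holder k r (λ P → t * p P) (λ P → p P * q P) Ps (crossing-bound G k t K-free)
    ∑tp≡tn : ∑ (λ P → t * p P) Ps ≡ t * n
    ∑tp≡tn = trans (∑-distribˡ-* t p Ps) (cong (t *_) ∑∣class∣≡n)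
  edge-bound : 2 * edgeCount G ≤ R + s * (c ∸ 1) * n
  edge-bound = begin
    2 * edgeCount G            ≤⟨ handshake G ⟩
    ∑ (degree G) (allFin n)    ≡⟨ ∑degree≡∑crossing G proper ⟩
    ∑ (crossing G) Ps          ≤⟨ ∑-mono-≤ Ps (λ P → m≤n+m∸n (crossing G P) (s * q P)) ⟩
    ∑ (λ P → s * q P + r P) Ps ≡⟨ ∑-distrib-+ (λ P → s * q P) r Ps ⟩
    ∑ (λ P → s * q P) Ps + R   ≡⟨ +-comm (∑ (λ P → s * q P) Ps) R ⟩
    R + ∑ (λ P → s * q P) Ps   ≡⟨ cong (R +_) (∑-distribˡ-* s q Ps) ⟩
    R + s * ∑ q Ps             ≡⟨ cong (λ z → R + s * z) ∑q≡[c∸1]n ⟩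
    R + s * ((c ∸ 1) * n)      ≡⟨ cong (R +_) (*-assoc s (c ∸ 1) n) ⟨
    R + s * (c ∸ 1) * n        ∎
    where
    open ≤-Reasoning
    ∑q≡[c∸1]n : ∑ q Ps ≡ (c ∸ 1) * n
    ∑q≡[c∸1]n = subst (λ L → ∑ q Ps ≡ (L ∸ 1) * n) (length-allFin c)
      (∑-complement p q Ps ∣class∣+∣outside∣≡n ∑∣class∣≡n)

-- Absorbing the linear error term

binomial-step : ∀ x k → suc x ^ suc k ≤ x ^ suc k + suc k * suc x ^ k
binomial-step x zero    = ≤-reflexive (linear x)
  where
  linear : ∀ x → suc x * 1 ≡ x * 1 + 1 * 1
  linear = solve-∀
binomial-step x (suc k) = begin
  suc x * suc x ^ suc k
    ≡⟨ +-comm (suc x ^ suc k) (x * suc x ^ suc k) ⟩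
  x * suc x ^ suc k + suc x ^ suc k
    ≤⟨ +-monoˡ-≤ (suc x ^ suc k) (*-monoʳ-≤ x (binomial-step x k)) ⟩
  x * (x ^ suc k + suc k * suc x ^ k) + suc x ^ suc k
    ≡⟨ cong (_+ suc x ^ suc k) (*-distribˡ-+ x (x ^ suc k) _) ⟩
  x * x ^ suc k + x * (suc k * suc x ^ k) + suc x ^ suc k
    ≤⟨ +-monoˡ-≤ (suc x ^ suc k) (+-monoʳ-≤ (x * x ^ suc k) x*[s*[1+x]ᵏ]≤s*[1+x]^[1+k]) ⟩
  x * x ^ suc k + suc k * suc x ^ suc k + suc x ^ suc k
    ≡⟨ +-assoc (x * x ^ suc k) (suc k * suc x ^ suc k) (suc x ^ suc k) ⟩
  x * x ^ suc k + (suc k * suc x ^ suc k + suc x ^ suc k)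
    ≡⟨ cong (x * x ^ suc k +_) (+-comm (suc k * suc x ^ suc k) (suc x ^ suc k)) ⟩
  x * x ^ suc k + suc (suc k) * suc x ^ suc k ∎
  where
  open ≤-Reasoning
  x*[s*[1+x]ᵏ]≤s*[1+x]^[1+k] : x * (suc k * suc x ^ k) ≤ suc k * suc x ^ suc k
  x*[s*[1+x]ᵏ]≤s*[1+x]^[1+k] = ≤-trans (≤-reflexive (x∙yz≈y∙xz x (suc k) (suc x ^ k)))
    (*-monoʳ-≤ (suc k) (*-monoˡ-≤ (suc x ^ k) (n≤1+n x)))

power-gap : ∀ k {B K} → B * suc k * 2 ^ k < K → B * suc K ^ suc k ≤ suc B * K ^ suc k
power-gap k {B} {K} B*s*2ᵏ<K = begin
  B * suc K ^ suc k
    ≤⟨ *-monoʳ-≤ B (binomial-step K k) ⟩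
  B * (K ^ suc k + suc k * suc K ^ k)
    ≡⟨ *-distribˡ-+ B (K ^ suc k) _ ⟩
  B * K ^ suc k + B * (suc k * suc K ^ k)
    ≤⟨ +-monoʳ-≤ (B * K ^ suc k) (*-monoʳ-≤ B (*-monoʳ-≤ (suc k) (^-monoˡ-≤ k 1+K≤2K))) ⟩
  B * K ^ suc k + B * (suc k * (2 * K) ^ k)
    ≡⟨ cong (λ z → B * K ^ suc k + B * (suc k * z)) (^-distribʳ-* 2 K k) ⟩
  B * K ^ suc k + B * (suc k * (2 ^ k * K ^ k))
    ≡⟨ cong (B * K ^ suc k +_) (reassoc B (suc k) (2 ^ k) (K ^ k)) ⟩
  B * K ^ suc k + B * suc k * 2 ^ k * K ^ k
    ≤⟨ +-monoʳ-≤ (B * K ^ suc k) (*-monoˡ-≤ (K ^ k) (<⇒≤ B*s*2ᵏ<K)) ⟩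
  B * K ^ suc k + K * K ^ k
    ≡⟨ +-comm (B * K ^ suc k) (K ^ suc k) ⟩
  suc B * K ^ suc k ∎
  where
  open ≤-Reasoning
  1≤K : 1 ≤ K
  1≤K = ≤-trans (s≤s z≤n) B*s*2ᵏ<K
  1+K≤2K : suc K ≤ 2 * K
  1+K≤2K = subst (suc K ≤_) (cong (K +_) (sym (+-identityʳ K)))
             (subst (_≤ K + K) (+-comm K 1) (+-monoʳ-≤ K 1≤K))
  reassoc : ∀ a b c d → a * (b * (c * d)) ≡ a * b * c * d
  reassoc a b c d = trans (sym (*-assoc a b (c * d))) (sym (*-assoc (a * b) c d))

n^[j+3]≤n^[2j+3] : ∀ j n → n ^ suc (suc (suc j)) ≤ n ^ (2 * suc (suc j) ∸ 1)
n^[j+3]≤n^[2j+3] j zero    = z≤n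
n^[j+3]≤n^[2j+3] j (suc n) = ^-monoʳ-≤ (suc n) (s≤s (≤-trans (s≤s (s≤s (m≤m+n j 0))) (m≤n+m _ j)))

-- Either R ≥ K c n, and then E ≤ (1 + 1/K) R with K so large that (1 + 1/K)^s costs at most
-- U/m; or R < K c n, and then E^s = O(n^s) is eventually below U = n^(2s-1).
absorb-linear-error : ∀ j a b m c → Σ ℕ λ N → ∀ n {R E} → N ≤ n →
  a * R ^ suc (suc j) ≤ b * n ^ (2 * suc (suc j) ∸ 1) → E ≤ R + c * n →
  m * a * E ^ suc (suc j) ≤ suc (m * b) * n ^ (2 * suc (suc j) ∸ 1)
absorb-linear-error j a b m c = N , bound
  where
  k = suc j
  s = suc k
  K = suc (m * b * s * 2 ^ k)
  N = m * a * (suc K * c) ^ s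
  bound : ∀ n {R E} → N ≤ n → a * R ^ s ≤ b * n ^ (2 * s ∸ 1) → E ≤ R + c * n →
    m * a * E ^ s ≤ suc (m * b) * n ^ (2 * s ∸ 1)
  bound n {R} {E} N≤n aRˢ≤bU E≤R+cn with K * (c * n) ≤? R
  ... | yes Kcn≤R = *-cancelˡ-≤ (K ^ s) {{m^n≢0 K s}} (begin
    K ^ s * (m * a * E ^ s)
      ≡⟨ x∙yz≈y∙xz (K ^ s) (m * a) (E ^ s) ⟩
    m * a * (K ^ s * E ^ s)
      ≡⟨ cong (m * a *_) (^-distribʳ-* K E s) ⟨
    m * a * (K * E) ^ s
      ≤⟨ *-monoʳ-≤ (m * a) (^-monoˡ-≤ s KE≤[1+K]R) ⟩
    m * a * (suc K * R) ^ s
      ≡⟨ cong (m * a *_) (^-distribʳ-* (suc K) R s) ⟩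
    m * a * (suc K ^ s * R ^ s)
      ≡⟨ *-interchange m a (suc K ^ s) (R ^ s) ⟩
    m * suc K ^ s * (a * R ^ s)
      ≤⟨ *-monoʳ-≤ (m * suc K ^ s) aRˢ≤bU ⟩
    m * suc K ^ s * (b * U)
      ≡⟨ trans (*-interchange m (suc K ^ s) b U) (sym (*-assoc (m * b) (suc K ^ s) U)) ⟩
    m * b * suc K ^ s * U
      ≤⟨ *-monoˡ-≤ U (power-gap k {m * b} (≤-refl {K})) ⟩
    suc (m * b) * K ^ s * U
      ≡⟨ xy∙z≈y∙xz (suc (m * b)) (K ^ s) U ⟩
    K ^ s * (suc (m * b) * U) ∎)
    where
    open ≤-Reasoning
    U = n ^ (2 * s ∸ 1)
    KE≤[1+K]R : K * E ≤ suc K * R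
    KE≤[1+K]R = begin
      K * E               ≤⟨ *-monoʳ-≤ K E≤R+cn ⟩
      K * (R + c * n)     ≡⟨ *-distribˡ-+ K R (c * n) ⟩
      K * R + K * (c * n) ≤⟨ +-monoʳ-≤ (K * R) Kcn≤R ⟩
      K * R + R           ≡⟨ +-comm (K * R) R ⟩
      suc K * R           ∎
  ... | no Kcn≰R = begin
    m * a * E ^ s                     ≤⟨ *-monoʳ-≤ (m * a) (^-monoˡ-≤ s E≤[1+K]cn) ⟩
    m * a * (suc K * c * n) ^ s       ≡⟨ cong (m * a *_) (^-distribʳ-* (suc K * c) n s) ⟩
    m * a * ((suc K * c) ^ s * n ^ s) ≡⟨ *-assoc (m * a) ((suc K * c) ^ s) (n ^ s) ⟨
    N * n ^ s                         ≤⟨ *-monoˡ-≤ (n ^ s) N≤n ⟩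
    n ^ suc s                         ≤⟨ n^[j+3]≤n^[2j+3] j n ⟩
    n ^ (2 * s ∸ 1)                   ≤⟨ m≤m+n (n ^ (2 * s ∸ 1)) _ ⟩
    suc (m * b) * n ^ (2 * s ∸ 1)     ∎
    where
    open ≤-Reasoning
    E≤[1+K]cn : E ≤ suc K * c * n
    E≤[1+K]cn = begin
      E                   ≤⟨ E≤R+cn ⟩
      R + c * n           ≤⟨ +-monoˡ-≤ (c * n) (<⇒≤ (≰⇒> Kcn≰R)) ⟩
      K * (c * n) + c * n ≡⟨ +-comm (K * (c * n)) (c * n) ⟩
      suc K * (c * n)     ≡⟨ *-assoc (suc K) c n ⟨
      suc K * c * n       ∎

tripartite-bound : ∀ j t m → Σ ℕ λ N → ∀ n → N ≤ n → (G : Graph n) → Colourable 3 G →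
  ¬ ContainsKst (suc (suc j)) (suc t) G →
  2 * suc m * (3 ^ suc j * edgeCount G ^ suc (suc j))
    ≤ suc m * t * n ^ (2 * suc (suc j) ∸ 1) + 2 * n ^ (2 * suc (suc j) ∸ 1)
tripartite-bound j t m = proj₁ absorb , bound
  where
  k = suc j
  s = suc k
  M = suc m
  absorb = absorb-linear-error j (3 ^ k) (t * 2 ^ k) M (s * 2)
  bound : ∀ n → proj₁ absorb ≤ n → (G : Graph n) → Colourable 3 G → ¬ ContainsKst s (suc t) G →
    2 * M * (3 ^ k * edgeCount G ^ s) ≤ M * t * n ^ (2 * s ∸ 1) + 2 * n ^ (2 * s ∸ 1)
  bound n N≤n G 3-colourable K-free = *-cancelˡ-≤ (2 ^ k) {{m^n≢0 2 k}} (begin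
    2 ^ k * (2 * M * (3 ^ k * e ^ s))     ≡⟨ regroupˡ (2 ^ k) M (3 ^ k) (e ^ s) ⟩
    M * 3 ^ k * (2 ^ s * e ^ s)           ≡⟨ cong (M * 3 ^ k *_) (^-distribʳ-* 2 e s) ⟨
    M * 3 ^ k * (2 * e) ^ s               ≤⟨ proj₂ absorb n {R} N≤n R-bound edge-bound ⟩
    suc (M * (t * 2 ^ k)) * U             ≡⟨ regroupʳ M t (2 ^ k) U ⟩
    U + 2 ^ k * (M * t * U)               ≤⟨ +-monoˡ-≤ (2 ^ k * (M * t * U)) U≤2ᵏ2U ⟩
    2 ^ k * (2 * U) + 2 ^ k * (M * t * U) ≡⟨ +-comm (2 ^ k * (2 * U)) (2 ^ k * (M * t * U)) ⟩
    2 ^ k * (M * t * U) + 2 ^ k * (2 * U) ≡⟨ *-distribˡ-+ (2 ^ k) (M * t * U) (2 * U) ⟨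
    2 ^ k * (M * t * U + 2 * U)           ∎)
    where
    open ≤-Reasoning
    bounds = multipartite-bound k t G 3-colourable K-free
    R = proj₁ bounds
    R-bound = proj₁ (proj₂ bounds)
    edge-bound = proj₂ (proj₂ bounds)
    e = edgeCount G
    U = n ^ (2 * s ∸ 1)
    U≤2ᵏ2U : U ≤ 2 ^ k * (2 * U)
    U≤2ᵏ2U = ≤-trans (m≤m+n U (U + 0)) (m≤n*m (2 * U) (2 ^ k) {{m^n≢0 2 k}})
    regroupˡ : ∀ x M y z → x * (2 * M * (y * z)) ≡ M * y * (2 * x * z)
    regroupˡ = solve-∀
    regroupʳ : ∀ M t x U → suc (M * (t * x)) * U ≡ U + x * (M * t * U)
    regroupʳ = solve-∀

-- From ℕ to ℚ

open import Data.Integer using (+_; +[1+_]; -[1+_]; +≤+)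
import Data.Integer as ℤ
import Data.Integer.Properties as ℤP
open import Data.Nat.Coprimality using (Coprime)
open import Data.Rational using (ℚ; _/_; mkℚ; Positive)
import Data.Rational as Q
import Data.Rational.Properties as QP
import Data.Rational.Unnormalised as U
import Data.Rational.Unnormalised.Properties as UP

ℕ-bound⇒ℚ-bound : ∀ X t W a d .(coprime : Coprime (suc a) (suc d)) →
  2 * suc d * X ≤ suc d * t * W + 2 * W →
  (+ X / 1) Q.≤ ((+ t / 2) Q.+ mkℚ (+ suc a) d coprime) Q.* (+ W / 1)
ℕ-bound⇒ℚ-bound X t W a d coprime 2mX≤mtW+2W =
  QP.toℚᵘ-cancel-≤ (UP.≤-respˡ-≃ (UP.≃-sym lhs≃) (UP.≤-respʳ-≃ (UP.≃-sym rhs≃) (U.*≤* ℤ-bound)))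
  where
  m = suc d
  ε = mkℚ (+ suc a) d coprime
  lhs≃ : Q.toℚᵘ (+ X / 1) U.≃ U.mkℚᵘ (+ X) 0
  lhs≃ = QP.toℚᵘ-fromℚᵘ (U.mkℚᵘ (+ X) 0)
  rhs≃ : Q.toℚᵘ (((+ t / 2) Q.+ ε) Q.* (+ W / 1)) U.≃ (U.mkℚᵘ (+ t) 1 U.+ Q.toℚᵘ ε) U.* U.mkℚᵘ (+ W) 0
  rhs≃ = UP.≃-trans (QP.toℚᵘ-homo-* ((+ t / 2) Q.+ ε) (+ W / 1))
    (UP.*-cong (UP.≃-trans (QP.toℚᵘ-homo-+ (+ t / 2) ε)
                           (UP.+-congˡ (Q.toℚᵘ ε) (QP.toℚᵘ-fromℚᵘ (U.mkℚᵘ (+ t) 1))))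
               (QP.toℚᵘ-fromℚᵘ (U.mkℚᵘ (+ W) 0)))
  -- ε ≥ 1/m is all that is used of ε.
  ℕ-bound : X * (2 * m * 1) ≤ (t * m + suc a * 2) * W * 1
  ℕ-bound = subst₂ _≤_ (lhs-form X m) (rhs-form t m a W)
    (≤-trans 2mX≤mtW+2W (+-monoʳ-≤ (m * t * W) (*-monoˡ-≤ W (*-monoʳ-≤ 2 (s≤s (z≤n {a}))))))
    where
    lhs-form : ∀ X m → 2 * m * X ≡ X * (2 * m * 1)
    lhs-form = solve-∀
    rhs-form : ∀ t m a W → m * t * W + 2 * suc a * W ≡ (t * m + suc a * 2) * W * 1
    rhs-form = solve-∀
  ℤ-bound : + X ℤ.* + (2 * m * 1) ℤ.≤ ((+ t ℤ.* + m ℤ.+ + suc a ℤ.* + 2) ℤ.* + W) ℤ.* + 1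
  ℤ-bound = subst₂ ℤ._≤_ (ℤP.pos-* X (2 * m * 1)) ℕ→ℤ (+≤+ ℕ-bound)
    where
    open ≡-Reasoning
    ℕ→ℤ : + ((t * m + suc a * 2) * W * 1) ≡ ((+ t ℤ.* + m ℤ.+ + suc a ℤ.* + 2) ℤ.* + W) ℤ.* + 1
    ℕ→ℤ = begin
      + ((t * m + suc a * 2) * W * 1)
        ≡⟨ ℤP.pos-* ((t * m + suc a * 2) * W) 1 ⟩
      + ((t * m + suc a * 2) * W) ℤ.* + 1
        ≡⟨ cong (ℤ._* + 1) (ℤP.pos-* (t * m + suc a * 2) W) ⟩
      (+ (t * m + suc a * 2) ℤ.* + W) ℤ.* + 1
        ≡⟨ cong (λ z → (z ℤ.* + W) ℤ.* + 1) (ℤP.pos-+ (t * m) (suc a * 2)) ⟩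
      ((+ (t * m) ℤ.+ + (suc a * 2)) ℤ.* + W) ℤ.* + 1
        ≡⟨ cong₂ (λ u v → ((u ℤ.+ v) ℤ.* + W) ℤ.* + 1) (ℤP.pos-* t m) (ℤP.pos-* (suc a) 2) ⟩
      ((+ t ℤ.* + m ℤ.+ + suc a ℤ.* + 2) ℤ.* + W) ℤ.* + 1 ∎

theorem1 : (s t : ℕ) → 2 ≤ s → s ≤ t → (ε : ℚ) → Positive ε →
    Σ ℕ λ N → (n : ℕ) → N ≤ n → (G : Graph n) → Colourable 3 G → ¬ ContainsKst s t G →
      (+ (3 ^ (s ∸ 1) * edgeCount G ^ s) / 1) Q.≤
        ((+ (t ∸ 1) / 2) Q.+ ε) Q.* (+ (n ^ (2 * s ∸ 1)) / 1)
theorem1 _ _ (s≤s (s≤s _)) (s≤s (s≤s _)) (mkℚ (+ zero)  _ _) ()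
theorem1 _ _ (s≤s (s≤s _)) (s≤s (s≤s _)) (mkℚ -[1+ _ ] _ _) ()
theorem1 .(suc (suc j)) .(suc (suc t′)) (s≤s (s≤s {n = j} _)) (s≤s (s≤s {n = t′} _))
         (mkℚ +[1+ a ] d coprime) _ =
  proj₁ bound , λ n N≤n G 3-colourable K-free →
    ℕ-bound⇒ℚ-bound (3 ^ suc j * edgeCount G ^ suc (suc j)) (suc t′) (n ^ (2 * suc (suc j) ∸ 1)) a d coprime
      (proj₂ bound n N≤n G 3-colourable K-free)
  where
  bound = tripartite-bound j (suc t′) d
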